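{- Let $G=(G,G^{W},\Vdash^{G},\ell^{G})$ be a modular graph with complementarity, let $x,y$ be vertices with $x\smile y$, and let $z$ be a vertex with $(x,y)\Vdash^{G} z$. Then $z\in\bot^{G^{W}}$ if and only if $(x,y)\in\bot^{G^{\smile}}$.
   Context: Reflexive graphs have vertices, edges, source/target maps and identity edges; an edge $e\colon x'\to x$ is read as a transition from $x$ to $x'$. A relation between reflexive graphs is a subgraph of their product; partially functional means each vertex/edge is related to at most one; its domain is the subgraph of related elements. $\Sigma$ is the reflexive graph with one vertex and edges $\mathit{id}$ and $\heartsuit$. A graph with complementarity is $(G,G^{W},\Vdash^{G},\ell^{G})$: $G$ a reflexive graph, $G^{W}$ a subgraph, $\Vdash^{G}\colon G\times G\nrightarrow G^{W}$ a relation, $\ell^{G}\colon G^{W}\to\Sigma$ a morphism of reflexive graphs, with the composite relation $G\times G\nrightarrow G^{W}\to\Sigma$ partially functional and symmetric. $G^{\smile}\subseteq G\times G$ is the domain of $\Vdash^{G}$, $x\smile y$ means $(x,y)\in G^{\smile}$, and $G^{\smile}$ is a graph over $\Sigma$ by sending $(x,y)$ to the unique $(x\Downarrow y)\in\Sigma$ related to it by the composite. $G$ is modular iff for all vertices with $(x,y)\Vdash^{G} z$: (1) every edge $e\colon z'\to z$ of $G^{W}$ admits edges $e_x\colon x'\to x$, $e_y\colon y'\to y$ with $(e_x,e_y)\Vdash^{G}e$; (2) for all edges $e_x\colon x'\to x$, $e_y\colon y'\to y$ with $e_x\smile e_y$ there is $e\colon z'\to z$ with $(e_x,e_y)\Vdash^{G}e$.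 For a reflexive graph $K$ with a morphism $\lambda\colon K\to\Sigma$: a path from $x'$ to $x$ is a finite (possibly empty) sequence of composable edges from $x'$ to $x$; write $x\Leftarrow x'$ if there is such a path all of whose edges are mapped to $\mathit{id}$, and $x\Leftarrow^{\heartsuit}x'$ if there is such a path whose image, after deleting identity edges, is exactly the one-edge sequence $(\heartsuit)$. Then $\bot^{K}$ is the set of vertices $x$ of $K$ such that for every $x'$ with $x\Leftarrow x'$ there exists $x''$ with $x'\Leftarrow^{\heartsuit}x''$. Here $G^{W}$ is over $\Sigma$ via $\ell^{G}$ and $G^{\smile}$ via $\Downarrow$. -}

module Defs where

open import Data.Unit using (⊤; tt)
open import Data.Product using (Σ; ∃; _×_; _,_; proj₁; proj₂)
open import Data.List using (List; []; _∷_)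
open import Data.List.Relation.Unary.All using (All)
open import Data.Irrelevant using (Irrelevant; [_])
open import Relation.Binary.PropositionalEquality using (_≡_; refl; cong)
open import Function using (_∘_)

-- Reflexive graphs.  An edge e with src e = x' and tgt e = x is
-- written e : x' → x (a transition from x to x').

record RGraph : Set₁ where
  field
    V      : Set
    E      : Set
    src    : E → V
    tgt    : E → V
    rid    : V → E
    src-id : ∀ v → src (rid v) ≡ v
    tgt-id : ∀ v → tgt (rid v) ≡ v
open RGraph public

record Morphism (G H : RGraph) : Set where
  field
    fV     : V G → V H
    fE     : E G → E H
    f-src  : ∀ e → fV (src G e) ≡ src H (fE e)
    f-tgt  : ∀ e → fV (tgt G e) ≡ tgt H (fE e)
    f-id   : ∀ v → fE (rid G v) ≡ rid H (fV v)
open Morphism public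

_⊗_ : RGraph → RGraph → RGraph
G ⊗ H = record
  { V = V G × V H
  ; E = E G × E H
  ; src = λ { (e , f) → src G e , src H f }
  ; tgt = λ { (e , f) → tgt G e , tgt H f }
  ; rid = λ { (x , y) → rid G x , rid H y }
  ; src-id = λ { (x , y) → cong₂' (src-id G x) (src-id H y) }
  ; tgt-id = λ { (x , y) → cong₂' (tgt-id G x) (tgt-id H y) }
  }
  where
  cong₂' : {A B : Set} {a a' : A} {b b' : B} → a ≡ a' → b ≡ b' → (a , b) ≡ (a' , b')
  cong₂' refl refl = refl

record Subgraph (G : RGraph) : Set₁ where
  field
    inV   : V G → Set
    inE   : E G → Set
    src-∈ : ∀ {e} → inE e → inV (src G e)
    tgt-∈ : ∀ {e} → inE e → inV (tgt G e)
    rid-∈ : ∀ {v} → inV v → inE (rid G v)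
open Subgraph public

-- the subgraph as a reflexive graph in its own right
-- (membership proofs are irrelevant, so it really is a sub-object)
private
  irr-≡ : {A : Set} {P : A → Set} {a b : A} .{p : P a} .{q : P b} →
          a ≡ b → _≡_ {A = Σ A (Irrelevant ∘ P)} (a , [ p ]) (b , [ q ])
  irr-≡ refl = refl

⟪_⟫ : {G : RGraph} → Subgraph G → RGraph
⟪_⟫ {G} S = record
  { V = Σ (V G) (Irrelevant ∘ inV S)
  ; E = Σ (E G) (Irrelevant ∘ inE S)
  ; src = λ { (e , [ p ]) → src G e , [ src-∈ S p ] }
  ; tgt = λ { (e , [ p ]) → tgt G e , [ tgt-∈ S p ] }
  ; rid = λ { (v , [ p ]) → rid G v , [ rid-∈ S p ] }
  ; src-id = λ { (v , [ p ]) → irr-≡ (src-id G v) }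
  ; tgt-id = λ { (v , [ p ]) → irr-≡ (tgt-id G v) }
  }

-- relations between reflexive graphs (subgraphs of the product)
record Rel (G H : RGraph) : Set₁ where
  field
    RV    : V G → V H → Set
    RE    : E G → E H → Set
    R-src : ∀ {e f} → RE e f → RV (src G e) (src H f)
    R-tgt : ∀ {e f} → RE e f → RV (tgt G e) (tgt H f)
    R-id  : ∀ {x y} → RV x y → RE (rid G x) (rid H y)
open Rel public

data ΣEdge : Set where
  idΣ ♡ : ΣEdge

ΣG : RGraph
ΣG = record
  { V = ⊤ ; E = ΣEdge ; src = λ _ → tt ; tgt = λ _ → tt
  ; rid = λ _ → idΣ ; src-id = λ _ → refl ; tgt-id = λ _ → refl }

swap : {A : Set} → A × A → A × A
swap (a , b) = b , a

record GraphWithComplementarity : Set₁ where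
  field
    G  : RGraph
    W  : Subgraph G
    ⊩  : Rel (G ⊗ G) ⟪ W ⟫
    ℓ  : Morphism ⟪ W ⟫ ΣG

  CV : V (G ⊗ G) → ⊤ → Set
  CV p u = ∃ λ w → RV ⊩ p w × fV ℓ w ≡ u

  CE : E (G ⊗ G) → ΣEdge → Set
  CE p s = ∃ λ w → RE ⊩ p w × fE ℓ w ≡ s

  field
    CV-functional : ∀ p u u' → CV p u → CV p u' → u ≡ u'
    CE-functional : ∀ p s s' → CE p s → CE p s' → s ≡ s'
    CV-symmetric  : ∀ p u → CV p u → CV (swap p) u
    CE-symmetric  : ∀ p s → CE p s → CE (swap p) s

  _⌣V_ : V G → V G → Set
  x ⌣V y = ∃ λ w → RV ⊩ (x , y) w

  _⌣E_ : E G → E G → Set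
  e ⌣E f = ∃ λ w → RE ⊩ (e , f) w

open GraphWithComplementarity public

Modular : GraphWithComplementarity → Set
Modular 𝒢 =
  ∀ (x y : V G') (z : V ⟪ W 𝒢 ⟫) → RV (⊩ 𝒢) (x , y) z →
    ( (∀ (e : E ⟪ W 𝒢 ⟫) → tgt ⟪ W 𝒢 ⟫ e ≡ z →
         ∃ λ ex → ∃ λ ey → tgt G' ex ≡ x × tgt G' ey ≡ y × RE (⊩ 𝒢) (ex , ey) e)
    × (∀ (ex ey : E G') → tgt G' ex ≡ x → tgt G' ey ≡ y → _⌣E_ 𝒢 ex ey →
         ∃ λ (e : E ⟪ W 𝒢 ⟫) → tgt ⟪ W 𝒢 ⟫ e ≡ z × RE (⊩ 𝒢) (ex , ey) e) )
  where G' = G 𝒢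

-- Graphs over Σ (only source, target and the labelling of edges
-- are needed for ⊥), paths, ⇐, ⇐♡ and ⊥.

record LGraph : Set₁ where
  field
    LV   : Set
    LE   : Set
    lsrc : LE → LV
    ltgt : LE → LV
    lab  : LE → ΣEdge
open LGraph public

data Path (K : LGraph) : LV K → LV K → Set where
  []  : ∀ {v} → Path K v v
  _∷_ : ∀ {b} (e : LE K) → Path K (ltgt K e) b → Path K (lsrc K e) b

labels : ∀ {K a b} → Path K a b → List ΣEdge
labels []              = []
labels {K} (e ∷ p)     = lab K e ∷ labels p

dropId : List ΣEdge → List ΣEdge
dropId []         = []
dropId (idΣ ∷ ls) = dropId ls
dropId (♡ ∷ ls)   = ♡ ∷ dropId ls

_⊢_⇐_ : (K : LGraph) → LV K → LV K → Set
K ⊢ x ⇐ x' = ∃ λ (p : Path K x' x) → All (_≡ idΣ) (labels p)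

_⊢_⇐♡_ : (K : LGraph) → LV K → LV K → Set
K ⊢ x ⇐♡ x' = ∃ λ (p : Path K x' x) → dropId (labels p) ≡ ♡ ∷ []

⊥∈ : (K : LGraph) → LV K → Set
⊥∈ K x = ∀ x' → K ⊢ x ⇐ x' → ∃ λ x'' → K ⊢ x' ⇐♡ x''

GW : GraphWithComplementarity → LGraph
GW 𝒢 = record
  { LV = V ⟪ W 𝒢 ⟫ ; LE = E ⟪ W 𝒢 ⟫
  ; lsrc = src ⟪ W 𝒢 ⟫ ; ltgt = tgt ⟪ W 𝒢 ⟫ ; lab = fE (ℓ 𝒢) }

-- vertices of G^⌣ : pairs in the domain of ⊩ (irrelevant membership);
-- edges of G^⌣ : pairs of edges together with a ⊩-related edge w, which
-- determines the label (x ⇓ y) = ℓ(w); by partial functionality of the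
-- composite this label does not depend on the choice of w.
G⌣ : GraphWithComplementarity → LGraph
G⌣ 𝒢 = record
  { LV = Σ (V (G 𝒢) × V (G 𝒢)) (λ p → Irrelevant (∃ λ w → RV (⊩ 𝒢) p w))
  ; LE = Σ (E (G 𝒢) × E (G 𝒢)) (λ p → ∃ λ w → RE (⊩ 𝒢) p w)
  ; lsrc = λ { (p , w , r) → src (G 𝒢 ⊗ G 𝒢) p , [ (src ⟪ W 𝒢 ⟫ w , R-src (⊩ 𝒢) r) ] }
  ; ltgt = λ { (p , w , r) → tgt (G 𝒢 ⊗ G 𝒢) p , [ (tgt ⟪ W 𝒢 ⟫ w , R-tgt (⊩ 𝒢) r) ] }
  ; lab  = λ { (p , w , r) → fE (ℓ 𝒢) w }
  }

pair⌣ : (𝒢 : GraphWithComplementarity) (x y : V (G 𝒢)) → .(_⌣V_ 𝒢 x y) → LV (G⌣ 𝒢)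
pair⌣ 𝒢 x y h = (x , y) , [ h ]

module Submission where

-- Relate a vertex u = (x , y) of G^⌣ to a vertex z of G^W when
-- (x , y) ⊩ z.  The two halves of modularity say precisely that along this
-- relation every edge into a related vertex lifts, in either direction, to an
-- edge into the partner vertex carrying the same Σ-label (for edges of G^⌣ the
-- label agrees by partial functionality of the composite G × G ↛ G^W → Σ).

open import Defs
open import Data.Product using (_,_; Σ; ∃; _×_; proj₁; proj₂)
open import Function using (flip; _∘_)
open import Function.Bundles using (_⇔_; mk⇔)
open import Data.List using ([]; _∷_)
open import Data.List.Relation.Unary.All using (All)
open import Relation.Binary.PropositionalEquality using (_≡_; refl; sym; cong; cong₂; subst)

module Lifting (K L : LGraph) (R : LV K → LV L → Set) where

  LiftsEdges : Set
  LiftsEdges = ∀ {a b} → R a b → (e : LE K) → ltgt K e ≡ a →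
    ∃ λ (f : LE L) → ltgt L f ≡ b × lab L f ≡ lab K e × R (lsrc K e) (lsrc L f)

  LiftsPaths : Set
  LiftsPaths = ∀ {a' a b} → R a b → (p : Path K a' a) →
    ∃ λ b' → R a' b' × Σ (Path L b' b) λ q → labels q ≡ labels p

  liftPaths : LiftsEdges → LiftsPaths
  liftPaths lift r [] = _ , r , [] , refl
  liftPaths lift r (e ∷ p) with liftPaths lift r p
  ... | b₁ , r₁ , q , labels≡ with lift r₁ e refl
  ...   | f , refl , lab≡ , r' = lsrc L f , r' , f ∷ q , cong₂ _∷_ lab≡ labels≡

  module _ (lift : LiftsPaths) where

    lift-⇐ : ∀ {a a' b} → R a b → K ⊢ a ⇐ a' → ∃ λ b' → R a' b' × L ⊢ b ⇐ b'
    lift-⇐ r (p , allId) with lift r p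
    ... | b' , r' , q , labels≡ = b' , r' , q , subst (All (_≡ idΣ)) (sym labels≡) allId

    lift-⇐♡ : ∀ {a a' b} → R a b → K ⊢ a ⇐♡ a' → ∃ λ b' → L ⊢ b ⇐♡ b'
    lift-⇐♡ r (p , single♡) with lift r p
    ... | b' , _ , q , labels≡ =
      b' , q , subst (λ ls → dropId ls ≡ ♡ ∷ []) (sym labels≡) single♡

transfer-⊥ : (K L : LGraph) (R : LV K → LV L → Set) →
  Lifting.LiftsPaths K L R → Lifting.LiftsPaths L K (flip R) →
  ∀ {a b} → R a b → ⊥∈ L b → ⊥∈ K a
transfer-⊥ K L R there back r b∈⊥ a' a⇐a' with Lifting.lift-⇐ K L R there r a⇐a'
... | b' , r' , b⇐b' with b∈⊥ b' b⇐b'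
...   | _ , b'⇐♡b'' = Lifting.lift-⇐♡ L K (flip R) back r' b'⇐♡b''

Realises : (𝒢 : GraphWithComplementarity) → LV (G⌣ 𝒢) → LV (GW 𝒢) → Set
Realises 𝒢 u z = RV (⊩ 𝒢) (proj₁ u) z

module _ (𝒢 : GraphWithComplementarity) (mod : Modular 𝒢) where

  splitEdges : Lifting.LiftsEdges (GW 𝒢) (G⌣ 𝒢) (flip (Realises 𝒢))
  splitEdges {b = (x , y) , _} r e refl with proj₁ (mod x y _ r) e refl
  ... | ex , ey , refl , refl , re = ((ex , ey) , e , re) , refl , refl , R-src (⊩ 𝒢) re

  combineEdges : Lifting.LiftsEdges (G⌣ 𝒢) (GW 𝒢) (Realises 𝒢)
  combineEdges r ((ex , ey) , w , rw) tgt≡ with proj₂ (mod _ _ _ r) ex ey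
      (cong (proj₁ ∘ proj₁) tgt≡) (cong (proj₂ ∘ proj₁) tgt≡) (w , rw)
  ... | e , tgt≡z , re =
    e , tgt≡z , CE-functional 𝒢 (ex , ey) _ _ (e , re , refl) (w , rw , refl) , R-src (⊩ 𝒢) re

proposition6p23 : (𝒢 : GraphWithComplementarity) → Modular 𝒢 →
    (x y : V (G 𝒢)) (x⌣y : _⌣V_ 𝒢 x y) (z : V ⟪ W 𝒢 ⟫) →
    RV (⊩ 𝒢) (x , y) z →
    ⊥∈ (GW 𝒢) z ⇔ ⊥∈ (G⌣ 𝒢) (pair⌣ 𝒢 x y x⌣y)
proposition6p23 𝒢 mod x y x⌣y z r = mk⇔
  (transfer-⊥ (G⌣ 𝒢) (GW 𝒢) (Realises 𝒢) combinePaths splitPaths r)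
  (transfer-⊥ (GW 𝒢) (G⌣ 𝒢) (flip (Realises 𝒢)) splitPaths combinePaths r)
  where
  splitPaths : Lifting.LiftsPaths (GW 𝒢) (G⌣ 𝒢) (flip (Realises 𝒢))
  splitPaths = Lifting.liftPaths (GW 𝒢) (G⌣ 𝒢) (flip (Realises 𝒢)) (splitEdges 𝒢 mod)

  combinePaths : Lifting.LiftsPaths (G⌣ 𝒢) (GW 𝒢) (Realises 𝒢)
  combinePaths = Lifting.liftPaths (G⌣ 𝒢) (GW 𝒢) (Realises 𝒢) (combineEdges 𝒢 mod)
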